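{- The variety $\mathsf{GL}_2$ does not have the amalgamation property.
   Context: An $\mathsf{FL}_{ew}$-algebra is a commutative integral residuated lattice with an extra constant $0$ as bottom. $\mathsf{GL}_2$ is the variety of $\mathsf{FL}_{ew}$-algebras generated by the totally ordered $\mathsf{FL}_{ew}$-algebras satisfying $x^2=x^3$ and, for all $x,y$, $x=1$ or $x(x\wedge y)\le(x\wedge y)^2$. A class has the amalgamation property if for all $\mathbf A,\mathbf B,\mathbf C$ in it and embeddings $i:\mathbf A\to\mathbf B$, $j:\mathbf A\to\mathbf C$ there exist $\mathbf D$ in the class and embeddings $h:\mathbf B\to\mathbf D$, $k:\mathbf C\to\mathbf D$ with $h\circ i=k\circ j$. -}

module Defs where

open import Level using (Level; suc; _⊔_)
open import Data.Nat using (ℕ)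
open import Data.Product using (Σ; _×_; _,_)
open import Data.Sum using (_⊎_)
open import Relation.Binary.PropositionalEquality using (_≡_)

record FLew (ℓ : Level) : Set (suc ℓ) where
  infixr 6 _∨_
  infixr 7 _∧_
  infixl 8 _·_
  infixr 5 _⇒_
  infix 4 _≤_
  field
    Carrier : Set ℓ
    _∧_ _∨_ _·_ _⇒_ : Carrier → Carrier → Carrier
    0# 1# : Carrier
  _≤_ : Carrier → Carrier → Set ℓ
  x ≤ y = x ∧ y ≡ x
  field
    ∧-comm   : ∀ x y → x ∧ y ≡ y ∧ x
    ∨-comm   : ∀ x y → x ∨ y ≡ y ∨ x
    ∧-assoc  : ∀ x y z → (x ∧ y) ∧ z ≡ x ∧ (y ∧ z)
    ∨-assoc  : ∀ x y z → (x ∨ y) ∨ z ≡ x ∨ (y ∨ z)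
    ∧-absorbs-∨ : ∀ x y → x ∧ (x ∨ y) ≡ x
    ∨-absorbs-∧ : ∀ x y → x ∨ (x ∧ y) ≡ x
    ·-comm   : ∀ x y → x · y ≡ y · x
    ·-assoc  : ∀ x y z → (x · y) · z ≡ x · (y · z)
    ·-identityʳ : ∀ x → x · 1# ≡ x
    residuated : ∀ x y z → ((x · y) ≤ z → y ≤ (x ⇒ z)) × (y ≤ (x ⇒ z) → (x · y) ≤ z)
    top : ∀ x → x ≤ 1#
    bot : ∀ x → 0# ≤ x

module _ {ℓ : Level} (A : FLew ℓ) where
  open FLew A

  IsTotal : Set ℓ
  IsTotal = ∀ x y → (x ≤ y) ⊎ (y ≤ x)

  IsGL2Chain : Set ℓ
  IsGL2Chain = IsTotal
             × (∀ x → x · x ≡ x · x · x)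
             × (∀ x y → (x ≡ 1#) ⊎ (x · (x ∧ y) ≤ (x ∧ y) · (x ∧ y)))

data Term : Set where
  var : ℕ → Term
  _∧ₜ_ _∨ₜ_ _·ₜ_ _⇒ₜ_ : Term → Term → Term
  0ₜ 1ₜ : Term

module _ {ℓ : Level} (A : FLew ℓ) where
  open FLew A

  eval : (ℕ → Carrier) → Term → Carrier
  eval ρ (var n)   = ρ n
  eval ρ (s ∧ₜ t)  = eval ρ s ∧ eval ρ t
  eval ρ (s ∨ₜ t)  = eval ρ s ∨ eval ρ t
  eval ρ (s ·ₜ t)  = eval ρ s · eval ρ t
  eval ρ (s ⇒ₜ t)  = eval ρ s ⇒ eval ρ t
  eval ρ 0ₜ        = 0#
  eval ρ 1ₜ        = 1#

  _⊨_≈_ : Term → Term → Set ℓ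
  _⊨_≈_ s t = ∀ (ρ : ℕ → Carrier) → eval ρ s ≡ eval ρ t

-- Membership in the variety GL_2 (= the equational class of all equations
-- valid in every GL_2-chain), with carriers at universe level ℓ.
InGL2 : {ℓ : Level} → FLew ℓ → Set (suc ℓ)
InGL2 {ℓ} A = ∀ (s t : Term)
            → (∀ (G : FLew ℓ) → IsGL2Chain G → G ⊨ s ≈ t)
            → A ⊨ s ≈ t

record Embedding {ℓ : Level} (A B : FLew ℓ) : Set ℓ where
  private
    module A = FLew A
    module B = FLew B
  field
    map      : A.Carrier → B.Carrier
    injective : ∀ x y → map x ≡ map y → x ≡ y
    pres-∧   : ∀ x y → map (x A.∧ y) ≡ map x B.∧ map y
    pres-∨   : ∀ x y → map (x A.∨ y) ≡ map x B.∨ map y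
    pres-·   : ∀ x y → map (x A.· y) ≡ map x B.· map y
    pres-⇒   : ∀ x y → map (x A.⇒ y) ≡ map x B.⇒ map y
    pres-0   : map A.0# ≡ B.0#
    pres-1   : map A.1# ≡ B.1#

open Embedding public

GL2HasAP : (ℓ : Level) → Set (suc ℓ)
GL2HasAP ℓ =
  ∀ (A B C : FLew ℓ) → InGL2 A → InGL2 B → InGL2 C
  → (i : Embedding A B) (j : Embedding A C)
  → Σ (FLew ℓ) λ D → InGL2 D ×
      Σ (Embedding B D) λ h → Σ (Embedding C D) λ k →
        (∀ a → map h (map i a) ≡ map k (map j a))

-- Every GL₂-chain satisfies  x ∨ (y ⇒ (x ⇒ y²)) = 1  and  (x ∨ y)² ⇒ (x ∨ y²) = 1,
-- hence so does every algebra in GL₂.  Write ¬x for x ⇒ 0.  If such an algebra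
-- contains an a with a² = 0 and ¬a = a (the middle element of the Łukasiewicz
-- chain Ł₃), then for every dense c (¬c = 0) the first identity at (c , a)
-- reads c ∨ a = 1, and the second one then gives 1 ⇒ c = 1, that is, c = 1.
-- The middle element of the Gödel chain G₃ is dense, so Ł₃ and G₃ have no
-- common extension in GL₂, although both contain the two-element chain 𝟚 in
-- the same way.
module Submission where

open import Defs
open import Algebra.Core using (Op₂)
open import Data.Bool.Base using (if_then_else_)
open import Data.Empty using (⊥)
open import Data.Fin.Base using (Fin; zero; suc; fromℕ)
open import Data.Fin.Properties using (all?; _≟_; _≤?_)
open import Data.Nat.Base using (ℕ; zero; suc)
open import Data.Product using (_,_; proj₁; proj₂)
import Data.Product as Product
open import Data.Sum using (inj₁; inj₂)
import Data.Sum as Sum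
open import Function.Base using (_∘_)
open import Level using (Level; 0ℓ; Lift; lift; lower)
open import Relation.Binary.PropositionalEquality
  using (_≡_; sym; trans; cong; cong₂; subst; module ≡-Reasoning)
open import Relation.Nullary using (¬_)
open import Relation.Nullary.Decidable
  using (Dec; does; True; toWitness; _×-dec_; _⊎-dec_; _→-dec_)

module FLewProperties {ℓ : Level} (A : FLew ℓ) where
  open FLew A

  ≤-refl : ∀ x → x ≤ x
  ≤-refl x = trans (cong (x ∧_) (sym (∨-absorbs-∧ x x))) (∧-absorbs-∨ x (x ∧ x))

  ≤-trans : ∀ {x y z} → x ≤ y → y ≤ z → x ≤ z
  ≤-trans {x} {y} {z} x≤y y≤z = begin
    x ∧ z         ≡⟨ cong (_∧ z) (sym x≤y) ⟩
    (x ∧ y) ∧ z   ≡⟨ ∧-assoc x y z ⟩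
    x ∧ (y ∧ z)   ≡⟨ cong (x ∧_) y≤z ⟩
    x ∧ y         ≡⟨ x≤y ⟩
    x             ∎
    where open ≡-Reasoning

  ≤-antisym : ∀ {x y} → x ≤ y → y ≤ x → x ≡ y
  ≤-antisym {x} {y} x≤y y≤x = trans (sym x≤y) (trans (∧-comm x y) y≤x)

  x≤x∨y : ∀ x y → x ≤ x ∨ y
  x≤x∨y = ∧-absorbs-∨

  y≤x∨y : ∀ x y → y ≤ x ∨ y
  y≤x∨y x y = subst (y ≤_) (∨-comm y x) (x≤x∨y y x)

  x≤y⇒x∨y≡y : ∀ {x y} → x ≤ y → x ∨ y ≡ y
  x≤y⇒x∨y≡y {x} {y} x≤y = begin
    x ∨ y         ≡⟨ ∨-comm x y ⟩
    y ∨ x         ≡⟨ cong (y ∨_) (trans (sym x≤y) (∧-comm x y)) ⟩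
    y ∨ (y ∧ x)   ≡⟨ ∨-absorbs-∧ y x ⟩
    y             ∎
    where open ≡-Reasoning

  1≤x⇒x≡1 : ∀ {x} → 1# ≤ x → x ≡ 1#
  1≤x⇒x≡1 {x} 1≤x = ≤-antisym (top x) 1≤x

  x∨1≡1 : ∀ x → x ∨ 1# ≡ 1#
  x∨1≡1 x = x≤y⇒x∨y≡y (top x)

  1∨x≡1 : ∀ x → 1# ∨ x ≡ 1#
  1∨x≡1 x = trans (∨-comm 1# x) (x∨1≡1 x)

  x∨0≡x : ∀ x → x ∨ 0# ≡ x
  x∨0≡x x = trans (∨-comm x 0#) (x≤y⇒x∨y≡y (bot x))

  ·-identityˡ : ∀ x → 1# · x ≡ x
  ·-identityˡ x = trans (·-comm 1# x) (·-identityʳ x)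

  residual-intro : ∀ {x y z} → x · y ≤ z → y ≤ x ⇒ z
  residual-intro {x} {y} {z} = proj₁ (residuated x y z)

  residual-elim : ∀ {x y z} → y ≤ x ⇒ z → x · y ≤ z
  residual-elim {x} {y} {z} = proj₂ (residuated x y z)

  x≤y⇒x⇒y≡1 : ∀ {x y} → x ≤ y → x ⇒ y ≡ 1#
  x≤y⇒x⇒y≡1 {x} {y} x≤y =
    1≤x⇒x≡1 (residual-intro (subst (_≤ y) (sym (·-identityʳ x)) x≤y))

  1⇒x≡x : ∀ x → 1# ⇒ x ≡ x
  1⇒x≡x x = ≤-antisym
    (subst (_≤ x) (·-identityˡ (1# ⇒ x)) (residual-elim (≤-refl (1# ⇒ x))))
    (residual-intro (subst (_≤ x) (sym (·-identityˡ x)) (≤-refl x)))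

  ·-monoˡ-≤ : ∀ {x y} z → x ≤ y → x · z ≤ y · z
  ·-monoˡ-≤ {x} {y} z x≤y = subst (_≤ y · z) (·-comm z x)
    (residual-elim (≤-trans x≤y (residual-intro (subst (_≤ y · z) (·-comm y z) (≤-refl (y · z))))))

  x²≤x : ∀ x → x · x ≤ x
  x²≤x x = subst (x · x ≤_) (·-identityˡ x) (·-monoˡ-≤ x (top x))

module GL2ChainProperties {ℓ : Level} (G : FLew ℓ) where
  open FLew G
  open FLewProperties G

  x∨[y⇒[x⇒y²]]≡1 : IsGL2Chain G → ∀ x y → x ∨ (y ⇒ (x ⇒ y · y)) ≡ 1#
  x∨[y⇒[x⇒y²]]≡1 (total , _ , law) x y with law x y
  ... | inj₁ x≡1 = trans (cong (_∨ (y ⇒ (x ⇒ y · y))) x≡1) (1∨x≡1 (y ⇒ (x ⇒ y · y)))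
  ... | inj₂ x[x∧y]≤[x∧y]² =
    trans (cong (x ∨_) (x≤y⇒x⇒y≡1 (residual-intro xy≤y²))) (x∨1≡1 x)
    where
    xy≤y² : x · y ≤ y · y
    xy≤y² with total x y
    ... | inj₁ x≤y = ·-monoˡ-≤ y x≤y
    ... | inj₂ y≤x = subst (λ w → x · w ≤ w · w) (trans (∧-comm x y) y≤x) x[x∧y]≤[x∧y]²

  [x∨y]²⇒[x∨y²]≡1 : IsTotal G → ∀ x y → (x ∨ y) · (x ∨ y) ⇒ (x ∨ y · y) ≡ 1#
  [x∨y]²⇒[x∨y²]≡1 total x y with total x y
  ... | inj₁ x≤y = trans (cong (λ w → w · w ⇒ (x ∨ y · y)) (x≤y⇒x∨y≡y x≤y)) (x≤y⇒x⇒y≡1 (y≤x∨y x (y · y)))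
  ... | inj₂ y≤x = trans (cong (λ w → w · w ⇒ (x ∨ y · y)) (trans (∨-comm x y) (x≤y⇒x∨y≡y y≤x)))
                         (x≤y⇒x⇒y≡1 (≤-trans (x²≤x x) (x≤x∨y x (y · y))))

GL2Chain⇒InGL2 : ∀ {ℓ} {G : FLew ℓ} → IsGL2Chain G → InGL2 G
GL2Chain⇒InGL2 {G = G} chain s t valid = valid G chain

valuation₂ : ∀ {a} {C : Set a} → C → C → ℕ → C
valuation₂ x y zero    = x
valuation₂ x y (suc _) = y

module GL2Properties {ℓ : Level} {D : FLew ℓ} (D∈GL2 : InGL2 D) where
  open FLew D
  open FLewProperties D

  private
    𝑥 𝑦 : Term
    𝑥 = var 0
    𝑦 = var 1

  x∨[y⇒[x⇒y²]]≡1 : ∀ x y → x ∨ (y ⇒ (x ⇒ y · y)) ≡ 1#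
  x∨[y⇒[x⇒y²]]≡1 x y = D∈GL2 (𝑥 ∨ₜ (𝑦 ⇒ₜ (𝑥 ⇒ₜ (𝑦 ·ₜ 𝑦)))) 1ₜ
    (λ G chain ρ → GL2ChainProperties.x∨[y⇒[x⇒y²]]≡1 G chain (ρ 0) (ρ 1))
    (valuation₂ x y)

  [x∨y]²⇒[x∨y²]≡1 : ∀ x y → (x ∨ y) · (x ∨ y) ⇒ (x ∨ y · y) ≡ 1#
  [x∨y]²⇒[x∨y²]≡1 x y = D∈GL2 (((𝑥 ∨ₜ 𝑦) ·ₜ (𝑥 ∨ₜ 𝑦)) ⇒ₜ (𝑥 ∨ₜ (𝑦 ·ₜ 𝑦))) 1ₜ
    (λ G chain ρ → GL2ChainProperties.[x∨y]²⇒[x∨y²]≡1 G (proj₁ chain) (ρ 0) (ρ 1))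
    (valuation₂ x y)

  dense≡1 : ∀ {a c} → a · a ≡ 0# → a ⇒ 0# ≡ a → c ⇒ 0# ≡ 0# → c ≡ 1#
  dense≡1 {a} {c} a²≡0 ¬a≡a ¬c≡0 = begin
    c                                ≡⟨ 1⇒x≡x c ⟨
    1# ⇒ c                           ≡⟨ cong₂ _⇒_ [c∨a]²≡1 c∨a²≡c ⟨
    (c ∨ a) · (c ∨ a) ⇒ (c ∨ a · a)  ≡⟨ [x∨y]²⇒[x∨y²]≡1 c a ⟩
    1#                               ∎
    where
    open ≡-Reasoning
    c∨a≡1 : c ∨ a ≡ 1#
    c∨a≡1 = begin
      c ∨ a                  ≡⟨ cong (c ∨_) ¬a≡a ⟨
      c ∨ (a ⇒ 0#)           ≡⟨ cong (λ w → c ∨ (a ⇒ w)) (trans (cong (c ⇒_) a²≡0) ¬c≡0) ⟨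
      c ∨ (a ⇒ (c ⇒ a · a))  ≡⟨ x∨[y⇒[x⇒y²]]≡1 c a ⟩
      1#                     ∎
    [c∨a]²≡1 : (c ∨ a) · (c ∨ a) ≡ 1#
    [c∨a]²≡1 = trans (cong (λ w → w · w) c∨a≡1) (·-identityʳ 1#)
    c∨a²≡c : c ∨ a · a ≡ c
    c∨a²≡c = trans (cong (c ∨_) a²≡0) (x∨0≡x c)

record FinOperations (k : ℕ) : Set where
  infixr 5 _⇒_
  infixr 6 _∨_
  infixr 7 _∧_
  infixl 8 _·_
  field
    _∧_ _∨_ _·_ _⇒_ : Op₂ (Fin k)
    0# 1# : Fin k

module _ {k : ℕ} (ops : FinOperations k) where
  open FinOperations ops

  flewLaws? : Dec _
  flewLaws? = (all? λ x → all? λ y → x ∧ y ≟ y ∧ x)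
    ×-dec (all? λ x → all? λ y → x ∨ y ≟ y ∨ x)
    ×-dec (all? λ x → all? λ y → all? λ z → (x ∧ y) ∧ z ≟ x ∧ (y ∧ z))
    ×-dec (all? λ x → all? λ y → all? λ z → (x ∨ y) ∨ z ≟ x ∨ (y ∨ z))
    ×-dec (all? λ x → all? λ y → x ∧ (x ∨ y) ≟ x)
    ×-dec (all? λ x → all? λ y → x ∨ (x ∧ y) ≟ x)
    ×-dec (all? λ x → all? λ y → x · y ≟ y · x)
    ×-dec (all? λ x → all? λ y → all? λ z → (x · y) · z ≟ x · (y · z))
    ×-dec (all? λ x → x · 1# ≟ x)
    ×-dec (all? λ x → all? λ y → all? λ z →
             ((x · y ∧ z ≟ x · y) →-dec (y ∧ (x ⇒ z) ≟ y))
             ×-dec ((y ∧ (x ⇒ z) ≟ y) →-dec (x · y ∧ z ≟ x · y)))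
    ×-dec (all? λ x → x ∧ 1# ≟ x)
    ×-dec (all? λ x → 0# ∧ x ≟ 0#)

  finFLew : True flewLaws? → FLew 0ℓ
  finFLew holds =
    let (∧-comm , ∨-comm , ∧-assoc , ∨-assoc , ∧-absorbs-∨ , ∨-absorbs-∧ ,
         ·-comm , ·-assoc , ·-identityʳ , residuated , top , bot) = toWitness holds
    in record
      { Carrier = Fin k ; _∧_ = _∧_ ; _∨_ = _∨_ ; _·_ = _·_ ; _⇒_ = _⇒_ ; 0# = 0# ; 1# = 1#
      ; ∧-comm = ∧-comm ; ∨-comm = ∨-comm ; ∧-assoc = ∧-assoc ; ∨-assoc = ∨-assoc
      ; ∧-absorbs-∨ = ∧-absorbs-∨ ; ∨-absorbs-∧ = ∨-absorbs-∧
      ; ·-comm = ·-comm ; ·-assoc = ·-assoc ; ·-identityʳ = ·-identityʳ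
      ; residuated = residuated ; top = top ; bot = bot
      }

  isGL2Chain? : (holds : True flewLaws?) → Dec (IsGL2Chain (finFLew holds))
  isGL2Chain? _ = (all? λ x → all? λ y → (x ∧ y ≟ x) ⊎-dec (y ∧ x ≟ y))
    ×-dec (all? λ x → x · x ≟ x · x · x)
    ×-dec (all? λ x → all? λ y → (x ≟ 1#) ⊎-dec (x · (x ∧ y) ∧ (x ∧ y) · (x ∧ y) ≟ x · (x ∧ y)))

module _ {k m : ℕ} {A : FinOperations k} {B : FinOperations m} where
  private
    module A = FinOperations A
    module B = FinOperations B

  embeddingLaws? : (f : Fin k → Fin m) → Dec _
  embeddingLaws? f = (all? λ x → all? λ y → (f x ≟ f y) →-dec (x ≟ y))
    ×-dec (all? λ x → all? λ y → f (x A.∧ y) ≟ f x B.∧ f y)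
    ×-dec (all? λ x → all? λ y → f (x A.∨ y) ≟ f x B.∨ f y)
    ×-dec (all? λ x → all? λ y → f (x A.· y) ≟ f x B.· f y)
    ×-dec (all? λ x → all? λ y → f (x A.⇒ y) ≟ f x B.⇒ f y)
    ×-dec (f A.0# ≟ B.0#)
    ×-dec (f A.1# ≟ B.1#)

  finEmbedding : {holdsᴬ : True (flewLaws? A)} {holdsᴮ : True (flewLaws? B)}
                 (f : Fin k → Fin m) → True (embeddingLaws? f) →
                 Embedding (finFLew A holdsᴬ) (finFLew B holdsᴮ)
  finEmbedding f holds =
    let (injective , pres-∧ , pres-∨ , pres-· , pres-⇒ , pres-0 , pres-1) = toWitness holds
    in record
      { map = f ; injective = injective
      ; pres-∧ = pres-∧ ; pres-∨ = pres-∨ ; pres-· = pres-· ; pres-⇒ = pres-⇒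
      ; pres-0 = pres-0 ; pres-1 = pres-1
      }

module _ {ℓ : Level} where

  liftFLew : FLew 0ℓ → FLew ℓ
  liftFLew A = record
    { Carrier = Lift ℓ Carrier
    ; _∧_ = lifted _∧_ ; _∨_ = lifted _∨_ ; _·_ = lifted _·_ ; _⇒_ = lifted _⇒_
    ; 0# = lift 0# ; 1# = lift 1#
    ; ∧-comm = λ x y → cong lift (∧-comm (lower x) (lower y))
    ; ∨-comm = λ x y → cong lift (∨-comm (lower x) (lower y))
    ; ∧-assoc = λ x y z → cong lift (∧-assoc (lower x) (lower y) (lower z))
    ; ∨-assoc = λ x y z → cong lift (∨-assoc (lower x) (lower y) (lower z))
    ; ∧-absorbs-∨ = λ x y → cong lift (∧-absorbs-∨ (lower x) (lower y))
    ; ∨-absorbs-∧ = λ x y → cong lift (∨-absorbs-∧ (lower x) (lower y))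
    ; ·-comm = λ x y → cong lift (·-comm (lower x) (lower y))
    ; ·-assoc = λ x y z → cong lift (·-assoc (lower x) (lower y) (lower z))
    ; ·-identityʳ = λ x → cong lift (·-identityʳ (lower x))
    ; residuated = λ x y z → Product.map liftImplication liftImplication
                               (residuated (lower x) (lower y) (lower z))
    ; top = λ x → cong lift (top (lower x))
    ; bot = λ x → cong lift (bot (lower x))
    }
    where
    open FLew A
    lifted : Op₂ Carrier → Op₂ (Lift ℓ Carrier)
    lifted _∙_ x y = lift (lower x ∙ lower y)
    liftImplication : ∀ {a b c d : Carrier} → (a ≡ b → c ≡ d) → lift {ℓ = ℓ} a ≡ lift b → lift {ℓ = ℓ} c ≡ lift d
    liftImplication f = cong lift ∘ f ∘ cong lower

  liftIsGL2Chain : {A : FLew 0ℓ} → IsGL2Chain A → IsGL2Chain (liftFLew A)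
  liftIsGL2Chain (total , x²≡x³ , law) =
      (λ x y → Sum.map (cong lift) (cong lift) (total (lower x) (lower y)))
    , (λ x → cong lift (x²≡x³ (lower x)))
    , (λ x y → Sum.map (cong lift) (cong lift) (law (lower x) (lower y)))

  liftEmbedding : {A B : FLew 0ℓ} → Embedding A B → Embedding (liftFLew A) (liftFLew B)
  liftEmbedding e = record
    { map = lift ∘ map e ∘ lower
    ; injective = λ x y → cong lift ∘ injective e (lower x) (lower y) ∘ cong lower
    ; pres-∧ = λ x y → cong lift (pres-∧ e (lower x) (lower y))
    ; pres-∨ = λ x y → cong lift (pres-∨ e (lower x) (lower y))
    ; pres-· = λ x y → cong lift (pres-· e (lower x) (lower y))
    ; pres-⇒ = λ x y → cong lift (pres-⇒ e (lower x) (lower y))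
    ; pres-0 = cong lift (pres-0 e)
    ; pres-1 = cong lift (pres-1 e)
    }

module _ {ℓ : Level} {A B : FLew ℓ} (e : Embedding A B) where
  private
    module A = FLew A
    module B = FLew B

  pres-¬ : ∀ x → map e (x A.⇒ A.0#) ≡ map e x B.⇒ B.0#
  pres-¬ x = trans (pres-⇒ e x A.0#) (cong (map e x B.⇒_) (pres-0 e))

_⊓_ _⊔_ : ∀ {k} → Op₂ (Fin k)
x ⊓ y = if does (x ≤? y) then x else y
x ⊔ y = if does (x ≤? y) then y else x

_⇒ᴳ_ : ∀ {n} → Op₂ (Fin (suc n))
_⇒ᴳ_ {n} x y = if does (x ≤? y) then fromℕ n else y

gödelOperations : (n : ℕ) → FinOperations (suc n)
gödelOperations n = record
  { _∧_ = _⊓_ ; _∨_ = _⊔_ ; _·_ = _⊓_ ; _⇒_ = _⇒ᴳ_ ; 0# = zero ; 1# = fromℕ n }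

𝟚 G₃ : FLew 0ℓ
𝟚  = finFLew (gödelOperations 1) _
G₃ = finFLew (gödelOperations 2) _

½ : Fin 3
½ = suc zero

-- On 0 < ½ < 1:  x · y = max 0 (x + y − 1)  and  x ⇒ y = min 1 (1 − x + y).
_·ᴸ_ _⇒ᴸ_ : Op₂ (Fin 3)
x              ·ᴸ suc (suc zero) = x
suc (suc zero) ·ᴸ y              = y
_              ·ᴸ _              = zero
zero           ⇒ᴸ _              = fromℕ 2
suc zero       ⇒ᴸ zero           = ½
suc zero       ⇒ᴸ _              = fromℕ 2
suc (suc zero) ⇒ᴸ y              = y

łukasiewicz₃Operations : FinOperations 3
łukasiewicz₃Operations = record
  { _∧_ = _⊓_ ; _∨_ = _⊔_ ; _·_ = _·ᴸ_ ; _⇒_ = _⇒ᴸ_ ; 0# = zero ; 1# = fromℕ 2 }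

Ł₃ : FLew 0ℓ
Ł₃ = finFLew łukasiewicz₃Operations _

𝟚-isGL2Chain : IsGL2Chain 𝟚
𝟚-isGL2Chain = toWitness {a? = isGL2Chain? (gödelOperations 1) _} _

G₃-isGL2Chain : IsGL2Chain G₃
G₃-isGL2Chain = toWitness {a? = isGL2Chain? (gödelOperations 2) _} _

Ł₃-isGL2Chain : IsGL2Chain Ł₃
Ł₃-isGL2Chain = toWitness {a? = isGL2Chain? łukasiewicz₃Operations _} _

ι : Fin 2 → Fin 3
ι zero    = zero
ι (suc _) = fromℕ 2

𝟚↪G₃ : Embedding 𝟚 G₃
𝟚↪G₃ = finEmbedding ι _

𝟚↪Ł₃ : Embedding 𝟚 Ł₃
𝟚↪Ł₃ = finEmbedding ι _

Ł₃-G₃-noJointGL2Extension : ∀ {ℓ} {D : FLew ℓ} → InGL2 D →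
  Embedding (liftFLew Ł₃) D → Embedding (liftFLew G₃) D → ⊥
Ł₃-G₃-noJointGL2Extension {D = D} D∈GL2 h k =
  ½≢1 (injective k (lift ½) (lift (fromℕ 2)) (trans c≡1 (sym (pres-1 k))))
  where
  open FLew D
  c≡1 : map k (lift ½) ≡ 1#
  c≡1 = GL2Properties.dense≡1 D∈GL2
    (trans (sym (pres-· h (lift ½) (lift ½))) (pres-0 h))
    (sym (pres-¬ h (lift ½)))
    (trans (sym (pres-¬ k (lift ½))) (pres-0 k))
  ½≢1 : ¬ lift {ℓ = _} ½ ≡ lift (fromℕ 2)
  ½≢1 ()

proposition6p13 : ∀ (ℓ : Level) → ¬ GL2HasAP ℓ
proposition6p13 ℓ hasAP =
  let (D , D∈GL2 , h , k , _) =
        hasAP (liftFLew 𝟚) (liftFLew Ł₃) (liftFLew G₃)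
              (liftChain∈GL2 𝟚 𝟚-isGL2Chain) (liftChain∈GL2 Ł₃ Ł₃-isGL2Chain)
              (liftChain∈GL2 G₃ G₃-isGL2Chain)
              (liftEmbedding {A = 𝟚} {B = Ł₃} 𝟚↪Ł₃) (liftEmbedding {A = 𝟚} {B = G₃} 𝟚↪G₃)
  in Ł₃-G₃-noJointGL2Extension D∈GL2 h k
  where
  -- The algebras are passed explicitly: inferring them from the types makes
  -- Agda unfold the finite algebras and compare their decided laws, which is slow.
  liftChain∈GL2 : (A : FLew 0ℓ) → IsGL2Chain A → InGL2 (liftFLew {ℓ} A)
  liftChain∈GL2 A = GL2Chain⇒InGL2 {G = liftFLew A} ∘ liftIsGL2Chain {A = A}
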